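{- Fix nonnegative integers $k,\ell$, positive integers $1\le m\le n$, and $\pi=\pi_1\cdots\pi_n\in\mathfrak{S}_{m,n}$. Then \[ \bigl|\{\alpha\in\mathrm{PF}_{m,n}(k,\ell):\mathcal{O}(\alpha)=\pi\}\bigr|=\prod_{i=1}^n\bigl[\mathrm{B}(\pi_i)+\mathrm{F}(\pi_i)+1\bigr], \] where $\mathrm{B}(0)=\mathrm{F}(0)=0$, and for $\pi_i>0$: $\mathrm{B}(\pi_i)=\min(\mathrm{Right}(\pi_i),k)$, and $\mathrm{F}(\pi_i)$ equals $0$ if $\mathrm{Left}(\pi_i)=0$, $\min(i-1,\ell)$ if $0<\mathrm{Left}(\pi_i)=i-1$, and $\max(\min(\mathrm{Left}(\pi_i)-k,\ell),0)$ if $0<\mathrm{Left}(\pi_i)<i-1$.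
   Context: $(k,\ell)$-pullback parking rule: given $\alpha=(a_1,\dots,a_m)\in[n]^m$, cars $1,\dots,m$ enter in order a one-way street with spots $1,\dots,n$. Car $j$ drives to spot $a_j$ and parks there if empty; otherwise it checks spots $a_j-1,\dots,a_j-k$ in order (stopping at the start of the street) and parks in the first empty one; if none, it checks spots $a_j+1,\dots,a_j+\ell$ in order (not beyond spot $n$) and parks in the first empty one; otherwise it fails. $\mathrm{PF}_{m,n}(k,\ell)$ is the set of $\alpha$ under which all cars park. $\mathfrak{S}_{m,n}$ is the set of words $\pi_1\cdots\pi_n$ that are permutations of the multiset of $n-m$ zeros and the elements of $[m]$; the outcome $\mathcal{O}(\alpha)$ has $\pi_u=j$ if car $j$ parks in spot $u$ and $\pi_u=0$ if spot $u$ is vacant. $\mathrm{Right}(\pi_i)$ is the largest $x\ge0$ with $0<\pi_t<\pi_i$ for all $i+1\le t\le i+x\le n$; $\mathrm{Left}(\pi_i)$ is the largest $x\ge0$ with $0<\pi_t<\pi_i$ for all $1\le i-x\le t\le i-1$. -}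

module Defs where

open import Data.Bool using (Bool; true; false; if_then_else_; _∧_)
open import Data.Nat using (ℕ; zero; suc; _+_; _∸_; _⊓_; _<ᵇ_; _≤ᵇ_; _≡ᵇ_)
open import Data.List using (List; []; _∷_; _++_; map; upTo; filterᵇ; concatMap;
  takeWhileᵇ; drop; take; reverse; length; replicate; filter)
open import Data.Nat.ListAction using (product)
open import Data.Maybe using (Maybe; just; nothing)
open import Relation.Binary.PropositionalEquality using (_≡_)
import Data.List.Properties as LP
import Data.Maybe.Properties as MP
import Data.Nat.Properties as NP

oneTo : ℕ → List ℕ
oneTo k = map suc (upTo k)

-- Street: list of length n; entry 0 = vacant spot, entry j > 0 = car j parked there.
-- Spots are 1-indexed. Out-of-range lookups return 1 (treated as occupied; never used).
at : List ℕ → ℕ → ℕ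
at []       _             = 1
at (x ∷ xs) zero          = 1
at (x ∷ xs) (suc zero)    = x
at (x ∷ xs) (suc (suc u)) = at xs (suc u)

setAt : List ℕ → ℕ → ℕ → List ℕ
setAt []       _             j = []
setAt (x ∷ xs) zero          j = x ∷ xs
setAt (x ∷ xs) (suc zero)    j = j ∷ xs
setAt (x ∷ xs) (suc (suc u)) j = x ∷ setAt xs (suc u) j

backSpots : ℕ → ℕ → List ℕ
backSpots k a = map (a ∸_) (filterᵇ (λ d → d <ᵇ a) (oneTo k))

forwardSpots : ℕ → ℕ → ℕ → List ℕ
forwardSpots ℓ n a = filterᵇ (λ s → s ≤ᵇ n) (map (a +_) (oneTo ℓ))

firstEmpty : List ℕ → List ℕ → Maybe ℕ
firstEmpty street []       = nothing
firstEmpty street (u ∷ us) = if at street u ≡ᵇ 0 then just u else firstEmpty street us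

parkCar : ℕ → ℕ → ℕ → List ℕ → ℕ → ℕ → Maybe (List ℕ)
parkCar k ℓ n street a j with firstEmpty street (a ∷ backSpots k a ++ forwardSpots ℓ n a)
... | nothing = nothing
... | just u  = just (setAt street u j)

runFrom : ℕ → ℕ → ℕ → ℕ → List ℕ → List ℕ → Maybe (List ℕ)
runFrom k ℓ n j street []       = just street
runFrom k ℓ n j street (a ∷ as) with parkCar k ℓ n street a j
... | nothing = nothing
... | just street' = runFrom k ℓ n (suc j) street' as

-- result of the parking process on n spots: just (outcome) if all cars park, nothing otherwise.
-- So  α ∈ PF_{m,n}(k,ℓ) with O(α) = π  iff  parkingOutcome k ℓ n α ≡ just π.
parkingOutcome : ℕ → ℕ → ℕ → List ℕ → Maybe (List ℕ)
parkingOutcome k ℓ n α = runFrom k ℓ n 1 (replicate n 0) α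

words : ℕ → ℕ → List (List ℕ)
words zero    n = [] ∷ []
words (suc m) n = concatMap (λ a → map (a ∷_) (words m n)) (oneTo n)

countOutcome : ℕ → ℕ → ℕ → ℕ → List ℕ → ℕ
countOutcome k ℓ m n π =
  length (filter (λ α → MP.≡-dec (LP.≡-dec NP._≟_) (parkingOutcome k ℓ n α) (just π)) (words m n))

baseWord : ℕ → ℕ → List ℕ
baseWord m n = replicate (n ∸ m) 0 ++ oneTo m

entry : List ℕ → ℕ → ℕ
entry π i = at π i

smallerPos : ℕ → ℕ → Bool
smallerPos p t = (0 <ᵇ t) ∧ (t <ᵇ p)

Right : List ℕ → ℕ → ℕ
Right π i = length (takeWhileᵇ (smallerPos (entry π i)) (drop i π))

Left : List ℕ → ℕ → ℕ
Left π i = length (takeWhileᵇ (smallerPos (entry π i)) (reverse (take (i ∸ 1) π)))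

B : ℕ → List ℕ → ℕ → ℕ
B k π i = if entry π i ≡ᵇ 0 then 0 else (Right π i ⊓ k)

-- max(min(L - k, ℓ), 0) = min(L ∸ k, ℓ) for natural numbers
F : ℕ → ℕ → List ℕ → ℕ → ℕ
F k ℓ π i =
  if entry π i ≡ᵇ 0 then 0
  else if Left π i ≡ᵇ 0 then 0
  else if Left π i ≡ᵇ (i ∸ 1) then ((i ∸ 1) ⊓ ℓ)
  else ((Left π i ∸ k) ⊓ ℓ)

productFormula : ℕ → ℕ → ℕ → List ℕ → ℕ
productFormula k ℓ n π = product (map (λ i → B k π i + F k ℓ π i + 1) (oneTo n))

-- Cars never move once parked, so if α ends in the outcome π, car v meets the street
-- streetBefore π v: π with every entry ≥ v erased. Hence α is counted iff every car v, facing
-- that street, parks at the spot i holding v in π, and the count is the product over v of the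
-- number of preferences achieving this. In that street the vacant spot i is flanked by maximal
-- occupied runs of length Right(π_i) on its right and Left(π_i) on its left. A preference a > i
-- reaches i iff the backward search from a gets to i without meeting a vacant spot first, i.e.
-- a ≤ i + min(Right(π_i), k). A preference a < i reaches i iff a lies in the left run, the
-- backward search from a finds nothing (it either hits the start of the street or stops short
-- of the vacant spot before the run), and the forward search gets to i, i.e. i ≤ a + F(π_i).
-- So the good preferences form the interval [i − F(π_i), i + B(π_i)].

module Submission where

open import Defs
open import Data.Bool using (Bool; true; false; if_then_else_; not; T; _∧_)
open import Data.Bool.Properties using (∧-zeroʳ; T-≡)
open import Data.Empty using (⊥-elim)
open import Data.List
  using (List; []; _∷_; _++_; _∷ʳ_; map; upTo; applyUpTo; filterᵇ; filter; concatMap;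
         length; replicate; drop; take; reverse; takeWhileᵇ)
open import Data.List.Relation.Binary.Permutation.Propositional using (_↭_; ↭-sym)
open import Data.List.Relation.Unary.All using (All)
open import Data.Maybe using (Maybe; just; nothing)
open import Data.Nat
open import Data.Nat.ListAction using (sum; product)
open import Data.Nat.ListAction.Properties using (product-↭; product-++)
open import Data.Nat.Properties
open import Data.Nat.Tactic.RingSolver using (solve-∀)
open import Data.Product using (∃; _×_; _,_; proj₁; proj₂)
open import Data.Sum using (_⊎_; inj₁; inj₂; [_,_]′)
open import Function using (_∘_; _⇔_; mk⇔; Equivalence)
open import Function.Construct.Composition using (_⇔-∘_)
open import Relation.Binary.Definitions using (DecidableEquality; tri<; tri≈; tri>)
open import Relation.Binary.PropositionalEquality
open import Relation.Nullary using (¬_; Dec; yes; no; does)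
open import Relation.Unary using (Decidable)

import Data.List.Properties as List
import Data.List.Relation.Binary.Permutation.Propositional.Properties as Perm
import Data.List.Relation.Unary.All as All
import Data.List.Relation.Unary.All.Properties as AllP
import Data.Maybe.Properties as Maybe

≤ᵇ-true : ∀ {m n} → m ≤ n → (m ≤ᵇ n) ≡ true
≤ᵇ-true m≤n = Equivalence.to T-≡ (≤⇒≤ᵇ m≤n)

<ᵇ-irrefl : ∀ v → (v <ᵇ v) ≡ false
<ᵇ-irrefl v with v <ᵇ v in v<v
... | false = refl
... | true  = ⊥-elim (<-irrefl refl (<ᵇ⇒< v v (subst T (sym v<v) _)))

true≢false : true ≢ false
true≢false ()

≤-+-⊓ : ∀ {a} i x y → a ≤ i + x → a ≤ i + y → a ≤ i + x ⊓ y
≤-+-⊓ i x y a≤i+x a≤i+y = ≤-trans (⊓-glb a≤i+x a≤i+y) (≤-reflexive (sym (+-distribˡ-⊓ i x y)))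

oneTo-suc : ∀ k → oneTo (suc k) ≡ 1 ∷ map suc (oneTo k)
oneTo-suc k = cong (λ xs → 1 ∷ map suc xs) (sym (List.map-upTo suc k))

oneTo≡applyUpTo : ∀ n → oneTo n ≡ applyUpTo suc n
oneTo≡applyUpTo = List.map-upTo suc

applyUpTo-cong : ∀ {A : Set} {f g : ℕ → A} n → (∀ t → t < n → f t ≡ g t) → applyUpTo f n ≡ applyUpTo g n
applyUpTo-cong zero    eq = refl
applyUpTo-cong (suc n) eq = cong₂ _∷_ (eq 0 z<s) (applyUpTo-cong n λ t t<n → eq (suc t) (s≤s t<n))

product-replicate-1 : ∀ r → product (replicate r 1) ≡ 1
product-replicate-1 zero    = refl
product-replicate-1 (suc r) = trans (+-identityʳ _) (product-replicate-1 r)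

length-filter-none : ∀ {A : Set} {P : A → Set} (P? : Decidable P) xs → (∀ x → ¬ P x) → length (filter P? xs) ≡ 0
length-filter-none P? xs ¬P = cong length (List.filter-none P? (All.universal ¬P xs))

length-filter-map : ∀ {A B : Set} {P : B → Set} (P? : Decidable P) (f : A → B) xs →
  length (filter P? (map f xs)) ≡ length (filter (P? ∘ f) xs)
length-filter-map P? f []       = refl
length-filter-map P? f (x ∷ xs) with does (P? (f x))
... | true  = cong suc (length-filter-map P? f xs)
... | false = length-filter-map P? f xs

length-filter-concatMap : ∀ {A B : Set} {P : B → Set} (P? : Decidable P) (g : A → List B) xs →
  length (filter P? (concatMap g xs)) ≡ sum (map (length ∘ filter P? ∘ g) xs)
length-filter-concatMap P? g []       = refl
length-filter-concatMap P? g (x ∷ xs) = begin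
  length (filter P? (g x ++ concatMap g xs))
    ≡⟨ cong length (List.filter-++ P? (g x) (concatMap g xs)) ⟩
  length (filter P? (g x) ++ filter P? (concatMap g xs))
    ≡⟨ List.length-++ (filter P? (g x)) ⟩
  length (filter P? (g x)) + length (filter P? (concatMap g xs))
    ≡⟨ cong (length (filter P? (g x)) +_) (length-filter-concatMap P? g xs) ⟩
  length (filter P? (g x)) + sum (map (length ∘ filter P? ∘ g) xs)
    ∎
  where open ≡-Reasoning

sum-map-if : ∀ {A : Set} {P : A → Set} (P? : Decidable P) c xs →
  sum (map (λ x → if does (P? x) then c else 0) xs) ≡ length (filter P? xs) * c
sum-map-if P? c []       = refl
sum-map-if P? c (x ∷ xs) with does (P? x)
... | true  = cong (c +_) (sum-map-if P? c xs)
... | false = sum-map-if P? c xs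

length-filter-interval : ∀ {A : Set} {P : A → Set} (P? : Decidable P) (f : ℕ → A) n lo len →
  lo + len ≤ n → (∀ t → t < n → P (f t) ⇔ (lo ≤ t × t < lo + len)) →
  length (filter P? (applyUpTo f n)) ≡ len
length-filter-interval P? f zero lo len bound _ = sym (n≤0⇒n≡0 (≤-trans (m≤n+m len lo) bound))
length-filter-interval P? f (suc n) lo len bound spec with P? (f 0) | Equivalence.to (spec 0 z<s) | Equivalence.from (spec 0 z<s)
length-filter-interval P? f (suc n) (suc lo) len bound spec | yes P[f0] | to | _ with () ← proj₁ (to P[f0])
length-filter-interval P? f (suc n) (suc lo) len bound spec | no _ | _ | _ =
  length-filter-interval P? (f ∘ suc) n lo len (s≤s⁻¹ bound) λ t t<n → mk⇔
    (λ P[ft] → let (lo<t , t<) = Equivalence.to (spec (suc t) (s≤s t<n)) P[ft] in s≤s⁻¹ lo<t , s≤s⁻¹ t<)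
    (λ (lo≤t , t<) → Equivalence.from (spec (suc t) (s≤s t<n)) (s≤s lo≤t , s≤s t<))
length-filter-interval P? f (suc n) zero zero bound spec | yes P[f0] | to | _ with () ← proj₂ (to P[f0])
length-filter-interval P? f (suc n) zero zero bound spec | no _ | _ | _ =
  length-filter-interval P? (f ∘ suc) n zero zero z≤n λ t t<n → mk⇔
    (λ P[ft] → ⊥-elim (<⇒≱ (proj₂ (Equivalence.to (spec (suc t) (s≤s t<n)) P[ft])) z≤n))
    λ { (_ , ()) }
length-filter-interval P? f (suc n) zero (suc len) bound spec | yes _ | _ | _ =
  cong suc (length-filter-interval P? (f ∘ suc) n zero len (s≤s⁻¹ bound) λ t t<n → mk⇔
    (λ P[ft] → z≤n , s≤s⁻¹ (proj₂ (Equivalence.to (spec (suc t) (s≤s t<n)) P[ft])))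
    (λ (_ , t<len) → Equivalence.from (spec (suc t) (s≤s t<n)) (z≤n , s≤s t<len)))
length-filter-interval P? f (suc n) zero (suc len) bound spec | no ¬P[f0] | _ | from =
  ⊥-elim (¬P[f0] (from (z≤n , z<s)))

length-takeWhileᵇ : ∀ (p : ℕ → Bool) xs → length (takeWhileᵇ p xs) ≤ length xs
length-takeWhileᵇ p []       = z≤n
length-takeWhileᵇ p (x ∷ xs) with p x
... | true  = s≤s (length-takeWhileᵇ p xs)
... | false = z≤n

takeWhileᵇ-holds : ∀ (p : ℕ → Bool) xs {d} → d < length (takeWhileᵇ p xs) → p (at xs (suc d)) ≡ true
takeWhileᵇ-holds p (x ∷ xs) {d} d<run with p x in px
takeWhileᵇ-holds p (x ∷ xs) {zero}  d<run | true = px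
takeWhileᵇ-holds p (x ∷ xs) {suc d} d<run | true = takeWhileᵇ-holds p xs (s≤s⁻¹ d<run)

takeWhileᵇ-stops : ∀ (p : ℕ → Bool) xs → length (takeWhileᵇ p xs) < length xs →
  p (at xs (suc (length (takeWhileᵇ p xs)))) ≡ false
takeWhileᵇ-stops p (x ∷ xs) run<len with p x in px
... | true  = takeWhileᵇ-stops p xs (s≤s⁻¹ run<len)
... | false = px

at-range : ∀ xs {u} → at xs u ≡ 0 → 1 ≤ u × u ≤ length xs
at-range (x ∷ xs) {suc zero}    _ = s≤s z≤n , s≤s z≤n
at-range (x ∷ xs) {suc (suc u)} e = s≤s z≤n , s≤s (proj₂ (at-range xs e))

at-map : ∀ (f : ℕ → ℕ) xs {t} → 1 ≤ t → t ≤ length xs → at (map f xs) t ≡ f (at xs t)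
at-map f (x ∷ xs) {suc zero}    _ _     = refl
at-map f (x ∷ xs) {suc (suc t)} _ t≤len = at-map f xs (s≤s z≤n) (s≤s⁻¹ t≤len)

at-drop : ∀ i xs d → at (drop i xs) (suc d) ≡ at xs (suc (i + d))
at-drop zero    xs       d = refl
at-drop (suc i) []       d = refl
at-drop (suc i) (x ∷ xs) d = at-drop i xs d

at-take : ∀ j xs {d} → d < j → at (take j xs) (suc d) ≡ at xs (suc d)
at-take (suc j) []       d<j = refl
at-take (suc j) (x ∷ xs) {zero}  d<j = refl
at-take (suc j) (x ∷ xs) {suc d} d<j = at-take j xs (s≤s⁻¹ d<j)

at-∷ʳ-< : ∀ zs y {d} → d < length zs → at (zs ∷ʳ y) (suc d) ≡ at zs (suc d)
at-∷ʳ-< (z ∷ zs) y {zero}  _     = refl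
at-∷ʳ-< (z ∷ zs) y {suc d} d<len = at-∷ʳ-< zs y (s≤s⁻¹ d<len)

at-∷ʳ-last : ∀ zs y → at (zs ∷ʳ y) (suc (length zs)) ≡ y
at-∷ʳ-last []       y = refl
at-∷ʳ-last (z ∷ zs) y = at-∷ʳ-last zs y

at-reverse : ∀ ys {d} → d < length ys → at (reverse ys) (suc d) ≡ at ys (suc (length ys ∸ suc d))
at-reverse (y ∷ ys) {d} d<len rewrite List.unfold-reverse y ys with m≤n⇒m<n∨m≡n (s≤s⁻¹ d<len)
... | inj₁ d<len′ = begin
  at (reverse ys ∷ʳ y) (suc d)                ≡⟨ at-∷ʳ-< (reverse ys) y (≤-trans d<len′ (≤-reflexive (sym (List.length-reverse ys)))) ⟩
  at (reverse ys) (suc d)                     ≡⟨ at-reverse ys d<len′ ⟩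
  at ys (suc (length ys ∸ suc d))             ≡⟨ cong (at (y ∷ ys) ∘ suc) (sym (+-∸-assoc 1 d<len′)) ⟩
  at (y ∷ ys) (suc (length (y ∷ ys) ∸ suc d)) ∎
  where open ≡-Reasoning
... | inj₂ refl = begin
  at (reverse ys ∷ʳ y) (suc (length ys))           ≡⟨ cong (at (reverse ys ∷ʳ y) ∘ suc) (sym (List.length-reverse ys)) ⟩
  at (reverse ys ∷ʳ y) (suc (length (reverse ys))) ≡⟨ at-∷ʳ-last (reverse ys) y ⟩
  y                                                ≡⟨ cong (at (y ∷ ys) ∘ suc) (sym (n∸n≡0 (length ys))) ⟩
  at (y ∷ ys) (suc (length ys ∸ length ys))        ∎
  where open ≡-Reasoning

at-reverse-take : ∀ xs {j d} → d < j → j ≤ length xs → at (reverse (take j xs)) (suc d) ≡ at xs (j ∸ d)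
at-reverse-take xs {j} {d} d<j j≤len = begin
  at (reverse (take j xs)) (suc d)                  ≡⟨ at-reverse (take j xs) (≤-trans d<j (≤-reflexive (sym length-take))) ⟩
  at (take j xs) (suc (length (take j xs) ∸ suc d)) ≡⟨ cong (λ m → at (take j xs) (suc (m ∸ suc d))) length-take ⟩
  at (take j xs) (suc (j ∸ suc d))                  ≡⟨ at-take j xs (∸-monoʳ-< z<s d<j) ⟩
  at xs (suc (j ∸ suc d))                           ≡⟨ cong (at xs) (sym (+-∸-assoc 1 d<j)) ⟩
  at xs (j ∸ d)                                     ∎
  where
  open ≡-Reasoning
  length-take : length (take j xs) ≡ j
  length-take = trans (List.length-take j xs) (m≤n⇒m⊓n≡m j≤len)

at-ext : ∀ xs ys → length xs ≡ length ys → (∀ t → t < length xs → at xs (suc t) ≡ at ys (suc t)) → xs ≡ ys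
at-ext []       []       _   _  = refl
at-ext (x ∷ xs) (y ∷ ys) len eq =
  cong₂ _∷_ (eq 0 z<s) (at-ext xs ys (suc-injective len) λ t t<len → eq (suc t) (s≤s t<len))

applyUpTo-at : ∀ (f : ℕ → ℕ) xs → applyUpTo (λ t → f (at xs (suc t))) (length xs) ≡ map f xs
applyUpTo-at f []       = refl
applyUpTo-at f (x ∷ xs) = cong (f x ∷_) (applyUpTo-at f xs)

length-setAt : ∀ xs u y → length (setAt xs u y) ≡ length xs
length-setAt []       u             y = refl
length-setAt (x ∷ xs) zero          y = refl
length-setAt (x ∷ xs) (suc zero)    y = refl
length-setAt (x ∷ xs) (suc (suc u)) y = cong suc (length-setAt xs (suc u) y)

at-setAt-≡ : ∀ xs {u} y → 1 ≤ u → u ≤ length xs → at (setAt xs u y) u ≡ y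
at-setAt-≡ (x ∷ xs) {suc zero}    y _ _ = refl
at-setAt-≡ (x ∷ xs) {suc (suc u)} y _ u≤len = at-setAt-≡ xs y (s≤s z≤n) (s≤s⁻¹ u≤len)

at-setAt-≢ : ∀ xs {u w} y → w ≢ u → at (setAt xs u y) w ≡ at xs w
at-setAt-≢ []       {u}           {w}           y w≢u = refl
at-setAt-≢ (x ∷ xs) {zero}        {w}           y w≢u = refl
at-setAt-≢ (x ∷ xs) {suc zero}    {zero}        y w≢u = refl
at-setAt-≢ (x ∷ xs) {suc zero}    {suc zero}    y w≢u = ⊥-elim (w≢u refl)
at-setAt-≢ (x ∷ xs) {suc zero}    {suc (suc w)} y w≢u = refl
at-setAt-≢ (x ∷ xs) {suc (suc u)} {zero}        y w≢u = refl
at-setAt-≢ (x ∷ xs) {suc (suc u)} {suc zero}    y w≢u = refl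
at-setAt-≢ (x ∷ xs) {suc (suc u)} {suc (suc w)} y w≢u = at-setAt-≢ xs y (w≢u ∘ cong suc)

occurrences : ℕ → List ℕ → ℕ
occurrences v xs = length (filter (_≟ v) xs)

occurrences-∷ : ∀ x xs v → occurrences v xs ≤ occurrences v (x ∷ xs)
occurrences-∷ x xs v with does (x ≟ v)
... | true  = n≤1+n _
... | false = ≤-refl

occurrences-here : ∀ {x} xs {v} → x ≡ v → occurrences v (x ∷ xs) ≡ suc (occurrences v xs)
occurrences-here xs x≡v = cong length (List.filter-accept (_≟ _) x≡v)

occurrences-at : ∀ xs {v w} → 1 ≤ w → w ≤ length xs → at xs w ≡ v → 1 ≤ occurrences v xs
occurrences-at (x ∷ xs) {v} {suc zero} _ _ x≡v = ≤-trans (s≤s z≤n) (≤-reflexive (sym (occurrences-here xs x≡v)))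
occurrences-at (x ∷ xs) {v} {suc (suc w)} _ w≤len xs≡v =
  ≤-trans (occurrences-at xs (s≤s z≤n) (s≤s⁻¹ w≤len) xs≡v) (occurrences-∷ x xs v)

occurrences-twice : ∀ {x} xs {v w} → 1 ≤ w → w ≤ length xs → x ≡ v → at xs w ≡ v → 2 ≤ occurrences v (x ∷ xs)
occurrences-twice xs 1≤w w≤len x≡v xs≡v =
  ≤-trans (s≤s (occurrences-at xs 1≤w w≤len xs≡v)) (≤-reflexive (sym (occurrences-here xs x≡v)))

at-unique : ∀ xs {v w w′} → 1 ≤ w → w ≤ length xs → 1 ≤ w′ → w′ ≤ length xs →
  at xs w ≡ v → at xs w′ ≡ v → occurrences v xs ≤ 1 → w ≡ w′
at-unique (x ∷ xs) {w = suc zero} {suc zero} _ _ _ _ _ _ _ = refl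
at-unique (x ∷ xs) {w = suc zero} {suc (suc w′)} _ _ _ w′≤len x≡v xs≡v once =
  ⊥-elim (<⇒≱ (occurrences-twice xs (s≤s z≤n) (s≤s⁻¹ w′≤len) x≡v xs≡v) once)
at-unique (x ∷ xs) {w = suc (suc w)} {suc zero} _ w≤len _ _ xs≡v x≡v once =
  ⊥-elim (<⇒≱ (occurrences-twice xs (s≤s z≤n) (s≤s⁻¹ w≤len) x≡v xs≡v) once)
at-unique (x ∷ xs) {v} {suc (suc w)} {suc (suc w′)} _ w≤len _ w′≤len xs≡v xs≡v′ once =
  cong suc (at-unique xs (s≤s z≤n) (s≤s⁻¹ w≤len) (s≤s z≤n) (s≤s⁻¹ w′≤len) xs≡v xs≡v′
    (≤-trans (occurrences-∷ x xs v) once))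

occurrences-oneTo : ∀ m v → occurrences (suc v) (oneTo m) ≤ 1
occurrences-oneTo m v with v <? m
... | yes v<m = ≤-reflexive (trans (cong (occurrences (suc v)) (oneTo≡applyUpTo m))
  (length-filter-interval (_≟ suc v) suc m v 1 (≤-trans (≤-reflexive (+-comm v 1)) v<m)
    λ t t<m → mk⇔ (λ { refl → ≤-refl , ≤-reflexive (+-comm 1 t) })
                  (λ (v≤t , t<v+1) → cong suc (≤-antisym (s≤s⁻¹ (≤-trans t<v+1 (≤-reflexive (+-comm v 1)))) v≤t))))
... | no v≮m = ≤-trans (≤-reflexive (trans (cong (occurrences (suc v)) (oneTo≡applyUpTo m))
  (length-filter-interval (_≟ suc v) suc m m 0 (≤-reflexive (+-identityʳ m))
    λ t t<m → mk⇔ (λ { refl → ⊥-elim (v≮m t<m) }) λ (m≤t , _) → ⊥-elim (<⇒≱ t<m m≤t)))) z≤n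

spotsBelow : ℕ → ℕ → List ℕ
spotsBelow zero    a             = []
spotsBelow (suc k) zero          = []
spotsBelow (suc k) (suc zero)    = []
spotsBelow (suc k) (suc (suc a)) = suc a ∷ spotsBelow k (suc a)

spotsAbove : ℕ → ℕ → ℕ → List ℕ
spotsAbove zero    n a = []
spotsAbove (suc ℓ) n a = if suc a ≤ᵇ n then suc a ∷ spotsAbove ℓ n (suc a) else []

backSpots-suc : ∀ k a → backSpots (suc k) (suc a) ≡ map (a ∸_) (filterᵇ (_<ᵇ a) (0 ∷ oneTo k))
backSpots-suc k a = trans (cong (map (suc a ∸_) ∘ filterᵇ (_<ᵇ suc a)) (oneTo-suc k)) (shift (0 ∷ oneTo k))
  where
  shift : ∀ ds → map (suc a ∸_) (filterᵇ (_<ᵇ suc a) (map suc ds)) ≡ map (a ∸_) (filterᵇ (_<ᵇ a) ds)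
  shift []       = refl
  shift (d ∷ ds) with d <ᵇ a
  ... | true  = cong (a ∸ d ∷_) (shift ds)
  ... | false = shift ds

filterᵇ-<ᵇ0 : ∀ ds → filterᵇ (_<ᵇ 0) ds ≡ []
filterᵇ-<ᵇ0 []           = refl
filterᵇ-<ᵇ0 (zero  ∷ ds) = filterᵇ-<ᵇ0 ds
filterᵇ-<ᵇ0 (suc _ ∷ ds) = filterᵇ-<ᵇ0 ds

backSpots≡spotsBelow : ∀ k a → backSpots k a ≡ spotsBelow k a
backSpots≡spotsBelow zero    a             = refl
backSpots≡spotsBelow (suc k) zero          = cong (map (0 ∸_)) (filterᵇ-<ᵇ0 (oneTo (suc k)))
backSpots≡spotsBelow (suc k) (suc zero)    = trans (backSpots-suc k 0) (cong (map (0 ∸_)) (filterᵇ-<ᵇ0 (0 ∷ oneTo k)))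
backSpots≡spotsBelow (suc k) (suc (suc a)) =
  trans (backSpots-suc k (suc a)) (cong (suc a ∷_) (backSpots≡spotsBelow k (suc a)))

forwardSpots-suc : ∀ ℓ n a → forwardSpots (suc ℓ) n a ≡ filterᵇ (_≤ᵇ n) (suc a ∷ map (suc a +_) (oneTo ℓ))
forwardSpots-suc ℓ n a = cong (filterᵇ (_≤ᵇ n)) (begin
  map (a +_) (oneTo (suc ℓ))              ≡⟨ cong (map (a +_)) (oneTo-suc ℓ) ⟩
  a + 1 ∷ map (a +_) (map suc (oneTo ℓ))  ≡⟨ cong₂ _∷_ (+-comm a 1) (sym (List.map-∘ (oneTo ℓ))) ⟩
  suc a ∷ map (λ d → a + suc d) (oneTo ℓ) ≡⟨ cong (suc a ∷_) (List.map-cong (+-suc a) (oneTo ℓ)) ⟩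
  suc a ∷ map (suc a +_) (oneTo ℓ)        ∎)
  where open ≡-Reasoning

forwardSpots-beyond : ∀ ℓ {n a} → n ≤ a → forwardSpots ℓ n a ≡ []
forwardSpots-beyond zero    n≤a = refl
forwardSpots-beyond (suc ℓ) {n} {a} n≤a with suc a ≤ᵇ n in eq | forwardSpots-suc ℓ n a
... | true  | _    = ⊥-elim (<⇒≱ (≤ᵇ⇒≤ (suc a) n (subst T (sym eq) _)) n≤a)
... | false | unfold = trans unfold (forwardSpots-beyond ℓ (m≤n⇒m≤1+n n≤a))

forwardSpots≡spotsAbove : ∀ ℓ n a → forwardSpots ℓ n a ≡ spotsAbove ℓ n a
forwardSpots≡spotsAbove zero    n a = refl
forwardSpots≡spotsAbove (suc ℓ) n a with suc a ≤ᵇ n in eq | forwardSpots-suc ℓ n a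
... | true  | unfold = trans unfold (cong (suc a ∷_) (forwardSpots≡spotsAbove ℓ n (suc a)))
... | false | unfold = trans unfold (forwardSpots-beyond ℓ (<⇒≤ (≰⇒> (λ a<n → subst T eq (≤⇒≤ᵇ a<n)))))

candidates : ℕ → ℕ → ℕ → ℕ → List ℕ
candidates k ℓ n a = a ∷ spotsBelow k a ++ spotsAbove ℓ n a

candidates-spec : ∀ k ℓ n a → a ∷ backSpots k a ++ forwardSpots ℓ n a ≡ candidates k ℓ n a
candidates-spec k ℓ n a = cong₂ (λ xs ys → a ∷ xs ++ ys) (backSpots≡spotsBelow k a) (forwardSpots≡spotsAbove ℓ n a)

vacant : List ℕ → ℕ → Bool
vacant S t = at S t ≡ᵇ 0

module _ (S : List ℕ) where

  firstEmpty-vacant : ∀ us {u} → firstEmpty S us ≡ just u → at S u ≡ 0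
  firstEmpty-vacant (x ∷ us) eq with at S x ≡ᵇ 0 in x-vacant
  firstEmpty-vacant (x ∷ us) refl | true = ≡ᵇ⇒≡ (at S x) 0 (subst T (sym x-vacant) _)
  ... | false = firstEmpty-vacant us eq

  firstEmpty-in-street : ∀ us {u} → firstEmpty S us ≡ just u → 1 ≤ u × u ≤ length S
  firstEmpty-in-street us found = at-range S (firstEmpty-vacant us found)

  firstEmpty-++ˡ : ∀ xs ys {u} → firstEmpty S xs ≡ just u → firstEmpty S (xs ++ ys) ≡ just u
  firstEmpty-++ˡ (x ∷ xs) ys eq with at S x ≡ᵇ 0
  ... | true  = eq
  ... | false = firstEmpty-++ˡ xs ys eq

  firstEmpty-++ʳ : ∀ xs ys → firstEmpty S xs ≡ nothing → firstEmpty S (xs ++ ys) ≡ firstEmpty S ys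
  firstEmpty-++ʳ []       ys eq = refl
  firstEmpty-++ʳ (x ∷ xs) ys eq with at S x ≡ᵇ 0
  ... | false = firstEmpty-++ʳ xs ys eq

  firstEmpty-++⁻ : ∀ xs ys {u} → firstEmpty S (xs ++ ys) ≡ just u →
    firstEmpty S xs ≡ just u ⊎ (firstEmpty S xs ≡ nothing × firstEmpty S ys ≡ just u)
  firstEmpty-++⁻ []       ys eq = inj₂ (refl , eq)
  firstEmpty-++⁻ (x ∷ xs) ys eq with at S x ≡ᵇ 0
  ... | true  = inj₁ eq
  ... | false = firstEmpty-++⁻ xs ys eq

  firstEmpty-spotsBelow-nothing : ∀ k a → (∀ t → 1 ≤ t → t < a → a ≤ t + k → vacant S t ≡ false) →
    firstEmpty S (spotsBelow k a) ≡ nothing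
  firstEmpty-spotsBelow-nothing zero    a             occupied = refl
  firstEmpty-spotsBelow-nothing (suc k) zero          occupied = refl
  firstEmpty-spotsBelow-nothing (suc k) (suc zero)    occupied = refl
  firstEmpty-spotsBelow-nothing (suc k) (suc (suc a)) occupied
    rewrite occupied (suc a) (s≤s z≤n) ≤-refl (m<m+n (suc a) z<s) =
    firstEmpty-spotsBelow-nothing k (suc a) λ t 1≤t t<a a≤t+k →
      occupied t 1≤t (m<n⇒m<1+n t<a) (≤-trans (s≤s a≤t+k) (≤-reflexive (sym (+-suc t k))))

  firstEmpty-spotsBelow-nothing⁻¹ : ∀ k a → firstEmpty S (spotsBelow k a) ≡ nothing →
    ∀ t → 1 ≤ t → t < a → a ≤ t + k → vacant S t ≡ false
  firstEmpty-spotsBelow-nothing⁻¹ zero a _ t _ t<a a≤t+0 = ⊥-elim (<⇒≱ t<a (subst (a ≤_) (+-identityʳ t) a≤t+0))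
  firstEmpty-spotsBelow-nothing⁻¹ (suc k) (suc zero) _ (suc t) _ (s≤s ()) _
  firstEmpty-spotsBelow-nothing⁻¹ (suc k) (suc (suc a)) eq t 1≤t t<a a≤t+k with at S (suc a) ≡ᵇ 0 in a-vacant
  ... | false with m≤n⇒m<n∨m≡n (s≤s⁻¹ t<a)
  ...   | inj₂ refl = a-vacant
  ...   | inj₁ t<a′ = firstEmpty-spotsBelow-nothing⁻¹ k (suc a) eq t 1≤t t<a′
                        (s≤s⁻¹ (≤-trans a≤t+k (≤-reflexive (+-suc t k))))

  firstEmpty-spotsBelow-just : ∀ k a {u} → 1 ≤ u → u < a → a ≤ u + k → vacant S u ≡ true →
    (∀ t → u < t → t < a → vacant S t ≡ false) → firstEmpty S (spotsBelow k a) ≡ just u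
  firstEmpty-spotsBelow-just zero a _ u<a a≤u+0 _ _ = ⊥-elim (<⇒≱ u<a (subst (a ≤_) (+-identityʳ _) a≤u+0))
  firstEmpty-spotsBelow-just (suc k) (suc zero) {suc u} _ (s≤s ()) _ _ _
  firstEmpty-spotsBelow-just (suc k) (suc (suc a)) {u} 1≤u u<a a≤u+k u-vacant occupied
    with m≤n⇒m<n∨m≡n (s≤s⁻¹ u<a)
  ... | inj₂ refl rewrite u-vacant = refl
  ... | inj₁ u<a′ rewrite occupied (suc a) u<a′ ≤-refl =
    firstEmpty-spotsBelow-just k (suc a) 1≤u u<a′ (s≤s⁻¹ (≤-trans a≤u+k (≤-reflexive (+-suc u k)))) u-vacant
      λ t u<t t<a → occupied t u<t (m<n⇒m<1+n t<a)

  firstEmpty-spotsBelow-just⁻¹ : ∀ k a {u} → firstEmpty S (spotsBelow k a) ≡ just u →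
    u < a × a ≤ u + k × (∀ t → u < t → t < a → vacant S t ≡ false)
  firstEmpty-spotsBelow-just⁻¹ (suc k) (suc (suc a)) eq with at S (suc a) ≡ᵇ 0 in a-vacant
  firstEmpty-spotsBelow-just⁻¹ (suc k) (suc (suc a)) refl | true =
    ≤-refl , m<m+n (suc a) z<s , λ t a<t t<a → ⊥-elim (<⇒≱ a<t (s≤s⁻¹ t<a))
  ... | false with firstEmpty-spotsBelow-just⁻¹ k (suc a) eq
  ...   | u<a , a≤u+k , occupied =
    m<n⇒m<1+n u<a , ≤-trans (s≤s a≤u+k) (≤-reflexive (sym (+-suc _ k))) , λ t u<t t<a →
      [ (λ t<a′ → occupied t u<t t<a′) , (λ { refl → a-vacant }) ]′ (m≤n⇒m<n∨m≡n (s≤s⁻¹ t<a))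

  firstEmpty-spotsAbove-just : ∀ ℓ n a {u} → a < u → u ≤ a + ℓ → u ≤ n → vacant S u ≡ true →
    (∀ t → a < t → t < u → vacant S t ≡ false) → firstEmpty S (spotsAbove ℓ n a) ≡ just u
  firstEmpty-spotsAbove-just zero n a a<u u≤a+0 _ _ _ = ⊥-elim (<⇒≱ a<u (≤-trans u≤a+0 (≤-reflexive (+-identityʳ a))))
  firstEmpty-spotsAbove-just (suc ℓ) n a a<u u≤a+ℓ u≤n u-vacant occupied
    rewrite ≤ᵇ-true (≤-trans a<u u≤n) with m≤n⇒m<n∨m≡n a<u
  ... | inj₂ refl rewrite u-vacant = refl
  ... | inj₁ a<u′ rewrite occupied (suc a) ≤-refl a<u′ =
    firstEmpty-spotsAbove-just ℓ n (suc a) a<u′ (≤-trans u≤a+ℓ (≤-reflexive (+-suc a ℓ))) u≤n u-vacant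
      λ t a<t t<u → occupied t (≤-trans (n≤1+n _) a<t) t<u

  firstEmpty-spotsAbove-just⁻¹ : ∀ ℓ n a {u} → firstEmpty S (spotsAbove ℓ n a) ≡ just u →
    a < u × u ≤ a + ℓ × (∀ t → a < t → t < u → vacant S t ≡ false)
  firstEmpty-spotsAbove-just⁻¹ (suc ℓ) n a eq with suc a ≤ᵇ n
  ... | true with at S (suc a) ≡ᵇ 0 in a-vacant
  firstEmpty-spotsAbove-just⁻¹ (suc ℓ) n a refl | true | true =
    ≤-refl , ≤-trans (s≤s (m≤m+n a ℓ)) (≤-reflexive (sym (+-suc a ℓ))) , λ t a<t t<a → ⊥-elim (<⇒≱ a<t (s≤s⁻¹ t<a))
  ... | false with firstEmpty-spotsAbove-just⁻¹ ℓ n (suc a) eq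
  ...   | a<u , u≤a+ℓ , occupied =
    ≤-trans (n≤1+n _) a<u , ≤-trans u≤a+ℓ (≤-reflexive (sym (+-suc a ℓ))) , λ t a<t t<u →
      [ (λ a<t′ → occupied t a<t′ t<u) , (λ { refl → a-vacant }) ]′ (m≤n⇒m<n∨m≡n a<t)

parkCar-just : ∀ k ℓ n S a j {u} → firstEmpty S (candidates k ℓ n a) ≡ just u → parkCar k ℓ n S a j ≡ just (setAt S u j)
parkCar-just k ℓ n S a j found
  with firstEmpty S (a ∷ backSpots k a ++ forwardSpots ℓ n a) | trans (cong (firstEmpty S) (candidates-spec k ℓ n a)) found
... | _ | refl = refl

parkCar-just⁻¹ : ∀ k ℓ n S a j {S′} → parkCar k ℓ n S a j ≡ just S′ →
  ∃ λ u → firstEmpty S (candidates k ℓ n a) ≡ just u × setAt S u j ≡ S′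
parkCar-just⁻¹ k ℓ n S a j parked with firstEmpty S (a ∷ backSpots k a ++ forwardSpots ℓ n a) in found
parkCar-just⁻¹ k ℓ n S a j refl | just u = u , trans (sym (cong (firstEmpty S) (candidates-spec k ℓ n a))) found , refl

runFrom-keeps : ∀ k ℓ n j S α {π} → runFrom k ℓ n j S α ≡ just π → ∀ w → at S w ≢ 0 → at π w ≡ at S w
runFrom-keeps k ℓ n j S []      refl w _ = refl
runFrom-keeps k ℓ n j S (a ∷ α) done w occupied with parkCar k ℓ n S a j in parked
... | just S′ with u , found , refl ← parkCar-just⁻¹ k ℓ n S a j parked =
  trans (runFrom-keeps k ℓ n (suc j) S′ α done w (occupied ∘ trans (sym unchanged))) unchanged
  where
  unchanged : at S′ w ≡ at S w
  unchanged = at-setAt-≢ S j λ { refl → occupied (firstEmpty-vacant S (candidates k ℓ n a) found) }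

forwardReach : ℕ → ℕ → ℕ → ℕ → ℕ
forwardReach k ℓ L i = if L ≡ᵇ 0 then 0 else if L ≡ᵇ (i ∸ 1) then ((i ∸ 1) ⊓ ℓ) else ((L ∸ k) ⊓ ℓ)

data ForwardReach (k ℓ L i : ℕ) : ℕ → Set where
  no-left-run  : L ≡ 0 → ForwardReach k ℓ L i 0
  run-to-start : L ≡ i ∸ 1 → ForwardReach k ℓ L i ((i ∸ 1) ⊓ ℓ)
  run-inside   : L ≢ i ∸ 1 → ForwardReach k ℓ L i ((L ∸ k) ⊓ ℓ)

forwardReach-view : ∀ k ℓ L i → ForwardReach k ℓ L i (forwardReach k ℓ L i)
forwardReach-view k ℓ L i with L ≡ᵇ 0 in L≡0 | L ≡ᵇ (i ∸ 1) in L≡i∸1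
... | true  | _     = no-left-run (≡ᵇ⇒≡ L 0 (subst T (sym L≡0) _))
... | false | true  = run-to-start (≡ᵇ⇒≡ L (i ∸ 1) (subst T (sym L≡i∸1) _))
... | false | false = run-inside (λ eq → subst T L≡i∸1 (≡⇒≡ᵇ L (i ∸ 1) eq))

record Flanked (S : List ℕ) (n i L R : ℕ) : Set where
  field
    1≤i            : 1 ≤ i
    i≤n            : i ≤ n
    i-vacant       : vacant S i ≡ true
    right-occupied : ∀ t → i < t → t ≤ i + R → vacant S t ≡ false
    right-fits     : i + R ≤ n
    right-maximal  : i + R < n → vacant S (suc (i + R)) ≡ true
    left-occupied  : ∀ t → t < i → i ≤ t + L → vacant S t ≡ false
    left-fits      : L < i
    left-maximal   : ∀ p → 1 ≤ p → suc (L + p) ≡ i → vacant S p ≡ true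

module Landing (k ℓ : ℕ) {S : List ℕ} {n i L R : ℕ} (flanked : Flanked S n i L R) where
  open Flanked flanked

  reachB reachF : ℕ
  reachB = R ⊓ k
  reachF = forwardReach k ℓ L i

  LandsAt : ℕ → Set
  LandsAt a = firstEmpty S (candidates k ℓ n a) ≡ just i

  reachF<i : reachF < i
  reachF<i with forwardReach k ℓ L i | forwardReach-view k ℓ L i
  ... | _ | no-left-run _      = 1≤i
  ... | _ | run-to-start _     = ≤-<-trans (m⊓n≤m (i ∸ 1) ℓ) (∸-monoʳ-< z<s 1≤i)
  ... | _ | run-inside _       = ≤-<-trans (≤-trans (m⊓n≤m (L ∸ k) ℓ) (m∸n≤m L k)) left-fits

  leftBoundary : ℕ
  leftBoundary = i ∸ suc L

  leftBoundary-spec : suc (L + leftBoundary) ≡ i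
  leftBoundary-spec = m+[n∸m]≡n left-fits

  leftBoundary<i : leftBoundary < i
  leftBoundary<i = ≤-trans (s≤s (m≤n+m leftBoundary L)) (≤-reflexive leftBoundary-spec)

  1≤leftBoundary : L ≢ i ∸ 1 → 1 ≤ leftBoundary
  1≤leftBoundary L≢i∸1 with leftBoundary | leftBoundary-spec
  ... | zero  | spec = ⊥-elim (L≢i∸1 (sym (trans (cong (_∸ 1) (sym spec)) (+-identityʳ L))))
  ... | suc _ | _    = s≤s z≤n

  left-run-covers : ∀ {a} → 1 ≤ a → (∀ t → a ≤ t → t < i → vacant S t ≡ false) → i ≤ a + L
  left-run-covers {a} 1≤a occupied = begin
    i                       ≡⟨ sym leftBoundary-spec ⟩
    suc (L + leftBoundary)  ≡⟨ sym (+-suc L leftBoundary) ⟩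
    L + suc leftBoundary    ≤⟨ +-monoʳ-≤ L leftBoundary<a ⟩
    L + a                   ≡⟨ +-comm L a ⟩
    a + L                   ∎
    where
    open ≤-Reasoning
    leftBoundary<a : leftBoundary < a
    leftBoundary<a = ≰⇒> λ a≤lb → true≢false (trans
      (sym (left-maximal leftBoundary (≤-trans 1≤a a≤lb) leftBoundary-spec))
      (occupied leftBoundary a≤lb leftBoundary<i))

  left-run-to-start : L ≡ i ∸ 1 → ∀ t → 1 ≤ t → t < i → vacant S t ≡ false
  left-run-to-start L≡i∸1 t 1≤t t<i = left-occupied t t<i (begin
    i           ≡⟨ sym (m+[n∸m]≡n 1≤i) ⟩
    1 + (i ∸ 1) ≤⟨ +-monoˡ-≤ (i ∸ 1) 1≤t ⟩
    t + (i ∸ 1) ≡⟨ cong (t +_) (sym L≡i∸1) ⟩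
    t + L       ∎)
    where open ≤-Reasoning

  skips-preference : ∀ {a} → a ≢ i → LandsAt a →
    vacant S a ≡ false × firstEmpty S (spotsBelow k a ++ spotsAbove ℓ n a) ≡ just i
  skips-preference {a} a≢i lands with at S a ≡ᵇ 0
  ... | true  = ⊥-elim (a≢i (Maybe.just-injective lands))
  ... | false = refl , lands

  lands-from-above : ∀ {a} → i < a → a ≤ n → LandsAt a → a ≤ i + reachB
  lands-from-above {a} i<a a≤n lands with skips-preference (>⇒≢ i<a) lands
  ... | a-occupied , lands′ with firstEmpty-++⁻ S (spotsBelow k a) (spotsAbove ℓ n a) lands′
  ...   | inj₂ (_ , above) = ⊥-elim (<-asym i<a (proj₁ (firstEmpty-spotsAbove-just⁻¹ S ℓ n a above)))
  ...   | inj₁ below with firstEmpty-spotsBelow-just⁻¹ S k a below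
  ...     | _ , a≤i+k , between = ≤-+-⊓ i R k a≤i+R a≤i+k
    where
    occupied : ∀ t → i < t → t ≤ a → vacant S t ≡ false
    occupied t i<t t≤a = [ between t i<t , (λ { refl → a-occupied }) ]′ (m≤n⇒m<n∨m≡n t≤a)
    a≤i+R : a ≤ i + R
    a≤i+R = ≮⇒≥ λ i+R<a → true≢false (trans
      (sym (right-maximal (<-≤-trans i+R<a a≤n)))
      (occupied (suc (i + R)) (s≤s (m≤m+n i R)) i+R<a))

  forward-bound : ∀ {a} → 1 ≤ a → a < i → i ≤ a + ℓ → (∀ t → a ≤ t → t < i → vacant S t ≡ false) →
    firstEmpty S (spotsBelow k a) ≡ nothing → i ≤ a + reachF
  forward-bound {a} 1≤a a<i i≤a+ℓ occupied below with forwardReach k ℓ L i | forwardReach-view k ℓ L i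
  ... | _ | no-left-run refl = ⊥-elim (<⇒≱ a<i (≤-trans (left-run-covers 1≤a occupied) (≤-reflexive (+-identityʳ a))))
  ... | _ | run-to-start L≡i∸1 =
    ≤-+-⊓ a (i ∸ 1) ℓ (≤-trans (left-run-covers 1≤a occupied) (≤-reflexive (cong (a +_) L≡i∸1))) i≤a+ℓ
  ... | _ | run-inside L≢i∸1 = ≤-+-⊓ a (L ∸ k) ℓ i≤a+[L∸k] i≤a+ℓ
    where
    lb = leftBoundary
    1≤lb = 1≤leftBoundary L≢i∸1
    lb-vacant : vacant S lb ≡ true
    lb-vacant = left-maximal lb 1≤lb leftBoundary-spec
    lb<a : lb < a
    lb<a = ≰⇒> λ a≤lb → true≢false (trans (sym lb-vacant) (occupied lb a≤lb leftBoundary<i))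
    lb+k<a : lb + k < a
    lb+k<a = ≰⇒> λ a≤lb+k → true≢false (trans (sym lb-vacant)
      (firstEmpty-spotsBelow-nothing⁻¹ S k a below lb 1≤lb lb<a a≤lb+k))
    i≤a+[L∸k] : i ≤ a + (L ∸ k)
    i≤a+[L∸k] = begin
      i                          ≡⟨ sym leftBoundary-spec ⟩
      suc (L + lb)               ≡⟨ cong suc (+-comm L lb) ⟩
      suc (lb + L)               ≤⟨ s≤s (+-monoʳ-≤ lb (m≤n+m∸n L k)) ⟩
      suc (lb + (k + (L ∸ k)))   ≡⟨ cong suc (sym (+-assoc lb k (L ∸ k))) ⟩
      suc (lb + k) + (L ∸ k)     ≤⟨ +-monoˡ-≤ (L ∸ k) lb+k<a ⟩
      a + (L ∸ k)                ∎
      where open ≤-Reasoning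

  lands-from-below : ∀ {a} → 1 ≤ a → a < i → LandsAt a → i ≤ a + reachF
  lands-from-below {a} 1≤a a<i lands with skips-preference (<⇒≢ a<i) lands
  ... | a-occupied , lands′ with firstEmpty-++⁻ S (spotsBelow k a) (spotsAbove ℓ n a) lands′
  ...   | inj₁ below = ⊥-elim (<-asym a<i (proj₁ (firstEmpty-spotsBelow-just⁻¹ S k a below)))
  ...   | inj₂ (below , above) with firstEmpty-spotsAbove-just⁻¹ S ℓ n a above
  ...     | _ , i≤a+ℓ , between = forward-bound 1≤a a<i i≤a+ℓ occupied below
    where
    occupied : ∀ t → a ≤ t → t < i → vacant S t ≡ false
    occupied t a≤t t<i = [ (λ a<t → between t a<t t<i) , (λ { refl → a-occupied }) ]′ (m≤n⇒m<n∨m≡n a≤t)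

  lands-at-i : LandsAt i
  lands-at-i rewrite i-vacant = refl

  reaches-from-above : ∀ {a} → i < a → a ≤ i + reachB → LandsAt a
  reaches-from-above {a} i<a a≤i+B with a≤i+R ← ≤-trans a≤i+B (+-monoʳ-≤ i (m⊓n≤m R k))
    rewrite right-occupied a i<a a≤i+R =
    firstEmpty-++ˡ S (spotsBelow k a) (spotsAbove ℓ n a)
      (firstEmpty-spotsBelow-just S k a 1≤i i<a (≤-trans a≤i+B (+-monoʳ-≤ i (m⊓n≤n R k))) i-vacant
        λ t i<t t<a → right-occupied t i<t (≤-trans (<⇒≤ t<a) a≤i+R))

  reaches-over-left-run : ∀ {a} → a < i → i ≤ a + ℓ → (∀ t → a ≤ t → t < i → vacant S t ≡ false) →
    (∀ t → 1 ≤ t → t < a → a ≤ t + k → vacant S t ≡ false) → LandsAt a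
  reaches-over-left-run {a} a<i i≤a+ℓ occupied-ahead occupied-behind rewrite occupied-ahead a ≤-refl a<i =
    trans (firstEmpty-++ʳ S (spotsBelow k a) (spotsAbove ℓ n a) (firstEmpty-spotsBelow-nothing S k a occupied-behind))
          (firstEmpty-spotsAbove-just S ℓ n a a<i i≤a+ℓ i≤n i-vacant λ t a<t → occupied-ahead t (<⇒≤ a<t))

  reaches-from-below : ∀ {a} → 1 ≤ a → a < i → i ≤ a + reachF → LandsAt a
  reaches-from-below {a} 1≤a a<i i≤a+F with forwardReach k ℓ L i | forwardReach-view k ℓ L i
  ... | _ | no-left-run _ = ⊥-elim (<⇒≱ a<i (≤-trans i≤a+F (≤-reflexive (+-identityʳ a))))
  ... | _ | run-to-start L≡i∸1 = reaches-over-left-run a<i (≤-trans i≤a+F (+-monoʳ-≤ a (m⊓n≤n (i ∸ 1) ℓ)))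
    (λ t a≤t → left-run-to-start L≡i∸1 t (≤-trans 1≤a a≤t))
    (λ t 1≤t t<a _ → left-run-to-start L≡i∸1 t 1≤t (<-trans t<a a<i))
  ... | _ | run-inside _ = reaches-over-left-run a<i (≤-trans i≤a+F (+-monoʳ-≤ a (m⊓n≤n (L ∸ k) ℓ)))
    (λ t a≤t t<i → left-occupied t t<i (≤-trans i≤a+L (+-monoˡ-≤ L a≤t)))
    (λ t _ t<a a≤t+k → left-occupied t (<-trans t<a a<i) (begin
      i                   ≤⟨ i≤a+[L∸k] ⟩
      a + (L ∸ k)         ≤⟨ +-monoˡ-≤ (L ∸ k) a≤t+k ⟩
      t + k + (L ∸ k)     ≡⟨ +-assoc t k (L ∸ k) ⟩
      t + (k + (L ∸ k))   ≡⟨ cong (t +_) (m+[n∸m]≡n k≤L) ⟩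
      t + L               ∎))
    where
    open ≤-Reasoning
    i≤a+[L∸k] : i ≤ a + (L ∸ k)
    i≤a+[L∸k] = ≤-trans i≤a+F (+-monoʳ-≤ a (m⊓n≤m (L ∸ k) ℓ))
    i≤a+L : i ≤ a + L
    i≤a+L = ≤-trans i≤a+[L∸k] (+-monoʳ-≤ a (m∸n≤m L k))
    k≤L : k ≤ L
    k≤L = ≮⇒≥ λ L<k → <⇒≱ a<i (≤-trans i≤a+[L∸k]
      (≤-reflexive (trans (cong (a +_) (m≤n⇒m∸n≡0 (<⇒≤ L<k))) (+-identityʳ a))))

  lands-at⇔ : ∀ {a} → 1 ≤ a → a ≤ n → LandsAt a ⇔ (i ≤ a + reachF × a ≤ i + reachB)
  lands-at⇔ {a} 1≤a a≤n with <-cmp a i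
  ... | tri< a<i _ _ = mk⇔
    (λ lands → lands-from-below 1≤a a<i lands , ≤-trans (<⇒≤ a<i) (m≤m+n i reachB))
    (λ (i≤a+F , _) → reaches-from-below 1≤a a<i i≤a+F)
  ... | tri≈ _ refl _ = mk⇔ (λ _ → m≤m+n a reachF , m≤m+n a reachB) (λ _ → lands-at-i)
  ... | tri> _ _ i<a = mk⇔
    (λ lands → ≤-trans (<⇒≤ i<a) (m≤m+n a reachF) , lands-from-above i<a a≤n lands)
    (λ (_ , a≤i+B) → reaches-from-above i<a a≤i+B)

keepBelow : ℕ → ℕ → ℕ
keepBelow v x = if x <ᵇ v then x else 0

streetBefore : List ℕ → ℕ → List ℕ
streetBefore π v = map (keepBelow v) π

keepBelow-one : ∀ x → keepBelow 1 x ≡ 0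
keepBelow-one zero    = refl
keepBelow-one (suc x) = refl

keepBelow-< : ∀ {v x} → x < v → keepBelow v x ≡ x
keepBelow-< {v} {x} x<v with x <ᵇ v in x<ᵇv
... | true  = refl
... | false = ⊥-elim (subst T x<ᵇv (<⇒<ᵇ x<v))

keepBelow-suc : ∀ v {x} → x ≢ v → keepBelow (suc v) x ≡ keepBelow v x
keepBelow-suc v {x} x≢v = cong (λ b → if b then x else 0) (<ᵇ-suc v x≢v)
  where
  <ᵇ-suc : ∀ v {x} → x ≢ v → (x <ᵇ suc v) ≡ (x <ᵇ v)
  <ᵇ-suc zero    {zero}  x≢v = ⊥-elim (x≢v refl)
  <ᵇ-suc zero    {suc x} x≢v = refl
  <ᵇ-suc (suc v) {zero}  x≢v = refl
  <ᵇ-suc (suc v) {suc x} x≢v = <ᵇ-suc v (x≢v ∘ cong suc)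

keepBelow-suc≡⇒ : ∀ v {x} → 1 ≤ v → keepBelow (suc v) x ≡ v → x ≡ v
keepBelow-suc≡⇒ v {x} 1≤v eq with x <ᵇ suc v
... | true  = eq
... | false = ⊥-elim (<⇒≢ 1≤v eq)

vacant-keepBelow : ∀ v x → (keepBelow v x ≡ᵇ 0) ≡ not (smallerPos v x)
vacant-keepBelow v zero with 0 <ᵇ v
... | true  = refl
... | false = refl
vacant-keepBelow v (suc x) with suc x <ᵇ v
... | true  = refl
... | false = refl

vacant-streetBefore : ∀ π v {t} → 1 ≤ t → t ≤ length π → vacant (streetBefore π v) t ≡ not (smallerPos v (at π t))
vacant-streetBefore π v 1≤t t≤len = trans (cong (_≡ᵇ 0) (at-map (keepBelow v) π 1≤t t≤len)) (vacant-keepBelow v _)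

streetBefore-one : ∀ π → streetBefore π 1 ≡ replicate (length π) 0
streetBefore-one []      = refl
streetBefore-one (x ∷ π) = cong₂ _∷_ (keepBelow-one x) (streetBefore-one π)

module RunsAround (π : List ℕ) (i₀ : ℕ) (i≤n : suc i₀ ≤ length π) where
  n = length π
  i = suc i₀
  1≤i : 1 ≤ i
  1≤i = s≤s z≤n
  p = smallerPos (at π i)
  S = streetBefore π (at π i)
  R = Right π i
  L = Left π i

  vacant≡ : ∀ {t} → 1 ≤ t → t ≤ n → vacant S t ≡ not (p (at π t))
  vacant≡ = vacant-streetBefore π (at π i)

  i-vacant : vacant S i ≡ true
  i-vacant = trans (vacant≡ 1≤i i≤n) (cong not (trans (cong ((0 <ᵇ at π i) ∧_) (<ᵇ-irrefl (at π i))) (∧-zeroʳ (0 <ᵇ at π i))))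

  right = drop i π

  length-right : length right ≡ n ∸ i
  length-right = List.length-drop i π

  right-fits : i + R ≤ n
  right-fits = begin
    i + R       ≤⟨ +-monoʳ-≤ i (≤-trans (length-takeWhileᵇ p right) (≤-reflexive length-right)) ⟩
    i + (n ∸ i) ≡⟨ m+[n∸m]≡n i≤n ⟩
    n           ∎
    where open ≤-Reasoning

  right-occupied : ∀ t → i < t → t ≤ i + R → vacant S t ≡ false
  right-occupied (suc t) i<t t≤i+R with d , refl ← m≤n⇒∃[o]m+o≡n (s≤s⁻¹ i<t) = begin
    vacant S (suc (i + d))              ≡⟨ vacant≡ (s≤s z≤n) (≤-trans t≤i+R right-fits) ⟩
    not (p (at π (suc (i + d))))        ≡⟨ cong (not ∘ p) (sym (at-drop i π d)) ⟩
    not (p (at right (suc d)))          ≡⟨ cong not (takeWhileᵇ-holds p right d<R) ⟩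
    false                               ∎
    where
    open ≡-Reasoning
    d<R : d < R
    d<R = +-cancelˡ-≤ i (suc d) R (≤-trans (≤-reflexive (+-suc i d)) t≤i+R)

  right-maximal : i + R < n → vacant S (suc (i + R)) ≡ true
  right-maximal i+R<n = begin
    vacant S (suc (i + R))              ≡⟨ vacant≡ (s≤s z≤n) i+R<n ⟩
    not (p (at π (suc (i + R))))        ≡⟨ cong (not ∘ p) (sym (at-drop i π R)) ⟩
    not (p (at right (suc R)))          ≡⟨ cong not (takeWhileᵇ-stops p right R<len) ⟩
    true                                ∎
    where
    open ≡-Reasoning
    R<len : R < length right
    R<len = +-cancelˡ-< i R (length right)
      (≤-trans i+R<n (≤-reflexive (sym (trans (cong (i +_) length-right) (m+[n∸m]≡n i≤n)))))

  left = reverse (take i₀ π)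

  i₀<n : i₀ < n
  i₀<n = i≤n

  length-left : length left ≡ i₀
  length-left = trans (List.length-reverse (take i₀ π)) (trans (List.length-take i₀ π) (m≤n⇒m⊓n≡m (<⇒≤ i₀<n)))

  L≤i₀ : L ≤ i₀
  L≤i₀ = ≤-trans (length-takeWhileᵇ p left) (≤-reflexive length-left)

  left-fits : L < i
  left-fits = s≤s L≤i₀

  left-occupied : ∀ t → t < i → i ≤ t + L → vacant S t ≡ false
  left-occupied zero    _   i≤L   = ⊥-elim (<⇒≱ left-fits i≤L)
  left-occupied (suc t) t<i i≤t+L with o , t+o≡i₀ ← m≤n⇒∃[o]m+o≡n (s≤s⁻¹ t<i) = begin
    vacant S (suc t)               ≡⟨ vacant≡ (s≤s z≤n) (≤-trans (<⇒≤ t<i) i≤n) ⟩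
    not (p (at π (suc t)))         ≡⟨ cong (not ∘ p ∘ at π) (sym i₀∸o≡t) ⟩
    not (p (at π (i₀ ∸ o)))        ≡⟨ cong (not ∘ p) (sym (at-reverse-take π (<-≤-trans o<L L≤i₀) (<⇒≤ i₀<n))) ⟩
    not (p (at left (suc o)))      ≡⟨ cong not (takeWhileᵇ-holds p left o<L) ⟩
    false                          ∎
    where
    open ≡-Reasoning
    i₀∸o≡t : i₀ ∸ o ≡ suc t
    i₀∸o≡t = trans (cong (_∸ o) (sym t+o≡i₀)) (m+n∸n≡m (suc t) o)
    o<L : o < L
    o<L = +-cancelˡ-< (suc t) o L (≤-trans (s≤s (≤-reflexive t+o≡i₀)) i≤t+L)

  left-maximal : ∀ q → 1 ≤ q → suc (L + q) ≡ i → vacant S q ≡ true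
  left-maximal q 1≤q L+q+1≡i = begin
    vacant S q                     ≡⟨ vacant≡ 1≤q (≤-trans (m≤n+m q L) (≤-trans (≤-reflexive (suc-injective L+q+1≡i)) (<⇒≤ i₀<n))) ⟩
    not (p (at π q))               ≡⟨ cong (not ∘ p ∘ at π) (sym i₀∸L≡q) ⟩
    not (p (at π (i₀ ∸ L)))        ≡⟨ cong (not ∘ p) (sym (at-reverse-take π L<i₀ (<⇒≤ i₀<n))) ⟩
    not (p (at left (suc L)))      ≡⟨ cong not (takeWhileᵇ-stops p left (≤-trans L<i₀ (≤-reflexive (sym length-left)))) ⟩
    true                           ∎
    where
    open ≡-Reasoning
    i₀∸L≡q : i₀ ∸ L ≡ q
    i₀∸L≡q = trans (cong (_∸ L) (sym (suc-injective L+q+1≡i))) (m+n∸m≡n L q)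
    L<i₀ : L < i₀
    L<i₀ = ≤-trans (m<m+n L 1≤q) (≤-reflexive (suc-injective L+q+1≡i))

streetBefore-flanked : ∀ π {i} → 1 ≤ i → i ≤ length π →
  Flanked (streetBefore π (at π i)) (length π) i (Left π i) (Right π i)
streetBefore-flanked π {suc i₀} _ i≤n = record
  { 1≤i = 1≤i ; i≤n = i≤n ; i-vacant = i-vacant
  ; right-occupied = right-occupied ; right-fits = right-fits ; right-maximal = right-maximal
  ; left-occupied = left-occupied ; left-fits = left-fits ; left-maximal = left-maximal
  }
  where open RunsAround π i₀ i≤n

_≟ˢ_ : DecidableEquality (Maybe (List ℕ))
_≟ˢ_ = Maybe.≡-dec (List.≡-dec _≟_)

CarsDistinct : List ℕ → Set
CarsDistinct π = ∀ {w w′} → 1 ≤ w → w ≤ length π → 1 ≤ w′ → w′ ≤ length π →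
  1 ≤ at π w → at π w ≡ at π w′ → w ≡ w′

module Outcome (k ℓ : ℕ) (π : List ℕ) (distinct : CarsDistinct π) where
  n = length π

  length-streetBefore : ∀ v → length (streetBefore π v) ≡ n
  length-streetBefore v = List.length-map (keepBelow v) π

  setAt-streetBefore : ∀ {i v} → 1 ≤ i → i ≤ n → 1 ≤ v → at π i ≡ v →
    setAt (streetBefore π v) i v ≡ streetBefore π (suc v)
  setAt-streetBefore {i} {v} 1≤i i≤n 1≤v πᵢ≡v = at-ext S′ (streetBefore π (suc v)) same-length same-at
    where
    S = streetBefore π v
    S′ = setAt S i v
    length-S′ : length S′ ≡ n
    length-S′ = trans (length-setAt S i v) (length-streetBefore v)
    same-length : length S′ ≡ length (streetBefore π (suc v))
    same-length = trans length-S′ (sym (length-streetBefore (suc v)))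
    same-at : ∀ t → t < length S′ → at S′ (suc t) ≡ at (streetBefore π (suc v)) (suc t)
    same-at t t<len with t<n ← ≤-trans t<len (≤-reflexive length-S′) | suc t ≟ i
    ... | yes refl = begin
      at S′ i                             ≡⟨ at-setAt-≡ S v 1≤i (≤-trans i≤n (≤-reflexive (sym (length-streetBefore v)))) ⟩
      v                                   ≡⟨ sym (keepBelow-< (n<1+n v)) ⟩
      keepBelow (suc v) v                 ≡⟨ cong (keepBelow (suc v)) (sym πᵢ≡v) ⟩
      keepBelow (suc v) (at π i)          ≡⟨ sym (at-map (keepBelow (suc v)) π 1≤i t<n) ⟩
      at (streetBefore π (suc v)) i       ∎
      where open ≡-Reasoning
    ... | no t+1≢i = begin
      at S′ (suc t)                       ≡⟨ at-setAt-≢ S v t+1≢i ⟩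
      at S (suc t)                        ≡⟨ at-map (keepBelow v) π (s≤s z≤n) t<n ⟩
      keepBelow v (at π (suc t))          ≡⟨ sym (keepBelow-suc v πₜ≢v) ⟩
      keepBelow (suc v) (at π (suc t))    ≡⟨ sym (at-map (keepBelow (suc v)) π (s≤s z≤n) t<n) ⟩
      at (streetBefore π (suc v)) (suc t) ∎
      where
      open ≡-Reasoning
      πₜ≢v : at π (suc t) ≢ v
      πₜ≢v πₜ≡v = t+1≢i
        (distinct (s≤s z≤n) t<n 1≤i i≤n (≤-trans 1≤v (≤-reflexive (sym πₜ≡v))) (trans πₜ≡v (sym πᵢ≡v)))

  parked-spot : ∀ {v a S′} → parkCar k ℓ n (streetBefore π v) a v ≡ just S′ →
    ∃ λ u → firstEmpty (streetBefore π v) (candidates k ℓ n a) ≡ just u × S′ ≡ setAt (streetBefore π v) u v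
          × 1 ≤ u × u ≤ n × at S′ u ≡ v
  parked-spot {v} {a} parked with u , found , refl ← parkCar-just⁻¹ k ℓ n (streetBefore π v) a v parked =
    u , found , refl , 1≤u , ≤-trans u≤len (≤-reflexive (length-streetBefore v)) , at-setAt-≡ (streetBefore π v) v 1≤u u≤len
    where
    1≤u = proj₁ (firstEmpty-in-street (streetBefore π v) (candidates k ℓ n a) found)
    u≤len = proj₂ (firstEmpty-in-street (streetBefore π v) (candidates k ℓ n a) found)

  ParksAsIn : ℕ → ℕ → Set
  ParksAsIn v a = parkCar k ℓ n (streetBefore π v) a v ≡ just (streetBefore π (suc v))

  parksAsIn? : ∀ v a → Dec (ParksAsIn v a)
  parksAsIn? v a = parkCar k ℓ n (streetBefore π v) a v ≟ˢ just (streetBefore π (suc v))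

  choices : ℕ → ℕ
  choices v = length (filter (parksAsIn? v) (oneTo n))

  parksAsIn⇔ : ∀ {i} a → 1 ≤ i → i ≤ n → 1 ≤ at π i →
    ParksAsIn (at π i) a ⇔ firstEmpty (streetBefore π (at π i)) (candidates k ℓ n a) ≡ just i
  parksAsIn⇔ {i} a 1≤i i≤n 1≤v = mk⇔ to from
    where
    v = at π i
    S = streetBefore π v
    to : ParksAsIn v a → firstEmpty S (candidates k ℓ n a) ≡ just i
    to parked with u , found , _ , 1≤u , u≤n , S′ᵤ≡v ← parked-spot parked = trans found (cong just u≡i)
      where
      πᵤ≡v : at π u ≡ v
      πᵤ≡v = keepBelow-suc≡⇒ v 1≤v (trans (sym (at-map (keepBelow (suc v)) π 1≤u u≤n)) S′ᵤ≡v)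
      u≡i : u ≡ i
      u≡i = distinct 1≤u u≤n 1≤i i≤n (≤-trans 1≤v (≤-reflexive (sym πᵤ≡v))) πᵤ≡v
    from : firstEmpty S (candidates k ℓ n a) ≡ just i → ParksAsIn v a
    from found = trans (parkCar-just k ℓ n S a v found) (cong just (setAt-streetBefore 1≤i i≤n 1≤v refl))

  choices≡ : ∀ {i} → 1 ≤ i → i ≤ n → 1 ≤ at π i →
    choices (at π i) ≡ Right π i ⊓ k + forwardReach k ℓ (Left π i) i + 1
  choices≡ {i} 1≤i i≤n 1≤v = begin
    choices v                                       ≡⟨ cong (length ∘ filter (parksAsIn? v)) (oneTo≡applyUpTo n) ⟩
    length (filter (parksAsIn? v) (applyUpTo suc n)) ≡⟨ length-filter-interval (parksAsIn? v) suc n lo len bound spec ⟩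
    len                                             ∎
    where
    open ≡-Reasoning
    flanked = streetBefore-flanked π 1≤i i≤n
    open Landing k ℓ flanked
    v = at π i
    -- the good preferences are a = t + 1 with lo ≤ t < lo + len, i.e. i − reachF ≤ a ≤ i + reachB
    lo = i ∸ suc reachF
    len = reachB + reachF + 1
    i≡ : suc reachF + lo ≡ i
    i≡ = m+[n∸m]≡n reachF<i
    lo+len≡i+B : lo + len ≡ i + reachB
    lo+len≡i+B = trans (rearrange lo reachB reachF) (cong (_+ reachB) i≡)
      where
      rearrange : ∀ lo B F → lo + (B + F + 1) ≡ suc F + lo + B
      rearrange = solve-∀
    bound : lo + len ≤ n
    bound = ≤-trans (≤-reflexive lo+len≡i+B) (≤-trans (+-monoʳ-≤ i (m⊓n≤m (Right π i) k)) (Flanked.right-fits flanked))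
    window : ∀ t → (i ≤ suc t + reachF × suc t ≤ i + reachB) ⇔ (lo ≤ t × t < lo + len)
    window t = mk⇔
      (λ (i≤t+1+F , t<i+B) →
        +-cancelʳ-≤ reachF lo t (≤-trans (≤-reflexive (+-comm lo reachF)) (s≤s⁻¹ (≤-trans (≤-reflexive i≡) i≤t+1+F))) ,
        ≤-trans t<i+B (≤-reflexive (sym lo+len≡i+B)))
      (λ (lo≤t , t<lo+len) →
        ≤-trans (≤-reflexive (sym i≡)) (s≤s (≤-trans (≤-reflexive (+-comm reachF lo)) (+-monoˡ-≤ reachF lo≤t))) ,
        ≤-trans t<lo+len (≤-reflexive lo+len≡i+B))
    spec : ∀ t → t < n → ParksAsIn v (suc t) ⇔ (lo ≤ t × t < lo + len)
    spec t t<n = window t ⇔-∘ (lands-at⇔ (s≤s z≤n) t<n ⇔-∘ parksAsIn⇔ (suc t) 1≤i i≤n 1≤v)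

  count : ℕ → List ℕ → ℕ → ℕ
  count j S r = length (filter (λ α → runFrom k ℓ n j S α ≟ˢ just π) (words r n))

  parked-as-in-outcome : ∀ {j a α S′} → 1 ≤ j → parkCar k ℓ n (streetBefore π j) a j ≡ just S′ →
    runFrom k ℓ n (suc j) S′ α ≡ just π → S′ ≡ streetBefore π (suc j)
  parked-as-in-outcome {j} {a} {α} {S′} 1≤j parked done
    with u , _ , placed , 1≤u , u≤n , S′ᵤ≡j ← parked-spot parked =
    trans placed (setAt-streetBefore 1≤u u≤n 1≤j πᵤ≡j)
    where
    πᵤ≡j : at π u ≡ j
    πᵤ≡j = trans (runFrom-keeps k ℓ n (suc j) S′ α done u λ S′ᵤ≡0 → <⇒≢ 1≤j (trans (sym S′ᵤ≡0) S′ᵤ≡j))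
                 S′ᵤ≡j

  count-first : ∀ j r a → 1 ≤ j →
    length (filter (λ α → runFrom k ℓ n j (streetBefore π j) (a ∷ α) ≟ˢ just π) (words r n))
      ≡ (if does (parksAsIn? j a) then count (suc j) (streetBefore π (suc j)) r else 0)
  count-first j r a 1≤j with parkCar k ℓ n (streetBefore π j) a j in parked
  ... | nothing = length-filter-none _ (words r n) λ _ ()
  ... | just S′ with List.≡-dec _≟_ S′ (streetBefore π (suc j))
  ...   | yes refl = refl
  ...   | no S′≢  = length-filter-none _ (words r n) λ α done → S′≢ (parked-as-in-outcome {α = α} 1≤j parked done)

  count-streetBefore : ∀ r j → 1 ≤ j → streetBefore π (j + r) ≡ π →
    count j (streetBefore π j) r ≡ product (applyUpTo (λ t → choices (j + t)) r)
  count-streetBefore zero j _ all-parked with List.≡-dec _≟_ (streetBefore π j) π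
  ... | yes _   = refl
  ... | no S≢π = ⊥-elim (S≢π (trans (cong (streetBefore π) (sym (+-identityʳ j))) all-parked))
  count-streetBefore (suc r) j 1≤j all-parked = begin
    count j S (suc r)
      ≡⟨ length-filter-concatMap _ (λ a → map (a ∷_) (words r n)) (oneTo n) ⟩
    sum (map (λ a → length (filter _ (map (a ∷_) (words r n)))) (oneTo n))
      ≡⟨ cong sum (List.map-cong (λ a → trans (length-filter-map _ (a ∷_) (words r n)) (count-first j r a 1≤j)) (oneTo n)) ⟩
    sum (map (λ a → if does (parksAsIn? j a) then count (suc j) S′ r else 0) (oneTo n))
      ≡⟨ sum-map-if (parksAsIn? j) _ (oneTo n) ⟩
    choices j * count (suc j) S′ r
      ≡⟨ cong (choices j *_) (count-streetBefore r (suc j) (s≤s z≤n) (trans (cong (streetBefore π) (sym (+-suc j r))) all-parked)) ⟩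
    choices j * product (applyUpTo (λ t → choices (suc j + t)) r)
      ≡⟨ cong₂ _*_ (cong choices (sym (+-identityʳ j))) (cong product (applyUpTo-cong r λ t _ → cong choices (sym (+-suc j t)))) ⟩
    product (applyUpTo (λ t → choices (j + t)) (suc r))
      ∎
    where
    open ≡-Reasoning
    S = streetBefore π j
    S′ = streetBefore π (suc j)

length-baseWord : ∀ {m n} → m ≤ n → length (baseWord m n) ≡ n
length-baseWord {m} {n} m≤n = begin
  length (replicate (n ∸ m) 0 ++ oneTo m)          ≡⟨ List.length-++ (replicate (n ∸ m) 0) ⟩
  length (replicate (n ∸ m) 0) + length (oneTo m)  ≡⟨ cong₂ _+_ (List.length-replicate (n ∸ m)) (List.length-map suc (upTo m)) ⟩
  n ∸ m + length (upTo m)                          ≡⟨ cong (n ∸ m +_) (List.length-upTo m) ⟩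
  n ∸ m + m                                        ≡⟨ m∸n+n≡m m≤n ⟩
  n                                                ∎
  where open ≡-Reasoning

baseWord-≤ : ∀ m n → All (_≤ m) (baseWord m n)
baseWord-≤ m n =
  AllP.++⁺ (AllP.replicate⁺ (n ∸ m) z≤n) (subst (All (_≤ m)) (sym (oneTo≡applyUpTo m)) (AllP.applyUpTo⁺₁ suc m λ t<m → t<m))

occurrences-baseWord : ∀ m n v → occurrences (suc v) (baseWord m n) ≤ 1
occurrences-baseWord m n v = ≤-trans (≤-reflexive no-zeros) (occurrences-oneTo m v)
  where
  no-zeros : occurrences (suc v) (replicate (n ∸ m) 0 ++ oneTo m) ≡ occurrences (suc v) (oneTo m)
  no-zeros = cong length (trans (List.filter-++ (_≟ suc v) (replicate (n ∸ m) 0) (oneTo m))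
    (cong (_++ filter (_≟ suc v) (oneTo m)) (List.filter-none (_≟ suc v) (AllP.replicate⁺ (n ∸ m) λ ()))))

↭baseWord⇒distinct : ∀ {m π} → π ↭ baseWord m (length π) → CarsDistinct π
↭baseWord⇒distinct {m} {π} π↭ {w} 1≤w w≤n 1≤w′ w′≤n 1≤πw πw≡πw′ =
  at-unique π 1≤w w≤n 1≤w′ w′≤n refl (sym πw≡πw′) (once (at π w) 1≤πw)
  where
  once : ∀ v → 1 ≤ v → occurrences v π ≤ 1
  once (suc v) _ = ≤-trans (≤-reflexive (Perm.↭-length (Perm.filter-↭ (_≟ suc v) π↭))) (occurrences-baseWord m (length π) v)

↭baseWord⇒streetBefore-all : ∀ {m π} → π ↭ baseWord m (length π) → streetBefore π (suc m) ≡ π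
↭baseWord⇒streetBefore-all {m} {π} π↭ =
  List.map-id-local (All.map (keepBelow-< ∘ s≤s) (Perm.All-resp-↭ (↭-sym π↭) (baseWord-≤ m (length π))))

module Factorisation (k ℓ m : ℕ) (π : List ℕ) (π↭ : π ↭ baseWord m (length π)) where
  open Outcome k ℓ π (↭baseWord⇒distinct {m} π↭)

  countOutcome≡ : countOutcome k ℓ m n π ≡ product (applyUpTo (choices ∘ suc) m)
  countOutcome≡ = begin
    count 1 (replicate n 0) m                 ≡⟨ cong (λ S → count 1 S m) (sym (streetBefore-one π)) ⟩
    count 1 (streetBefore π 1) m              ≡⟨ count-streetBefore m 1 (s≤s z≤n) (↭baseWord⇒streetBefore-all π↭) ⟩
    product (applyUpTo (choices ∘ suc) m)     ∎
    where open ≡-Reasoning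

  weight : ℕ → ℕ
  weight zero      = 1
  weight v@(suc _) = choices v

  summand : ℕ → ℕ
  summand i = B k π i + F k ℓ π i + 1

  summand≡weight : ∀ {i} → 1 ≤ i → i ≤ n → summand i ≡ weight (at π i)
  summand≡weight {i} 1≤i i≤n = by-entry (at π i) refl
    where
    summand-at : ∀ {x} → at π i ≡ x →
      summand i ≡ (if x ≡ᵇ 0 then 0 else Right π i ⊓ k) + (if x ≡ᵇ 0 then 0 else forwardReach k ℓ (Left π i) i) + 1
    summand-at = cong λ x → (if x ≡ᵇ 0 then 0 else Right π i ⊓ k) + (if x ≡ᵇ 0 then 0 else forwardReach k ℓ (Left π i) i) + 1
    by-entry : ∀ x → at π i ≡ x → summand i ≡ weight (at π i)
    by-entry zero    πᵢ≡0 = trans (summand-at πᵢ≡0) (cong weight (sym πᵢ≡0))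
    by-entry (suc v) πᵢ≡v = begin
      summand i                                          ≡⟨ summand-at πᵢ≡v ⟩
      Right π i ⊓ k + forwardReach k ℓ (Left π i) i + 1  ≡⟨ sym (choices≡ 1≤i i≤n (≤-trans (s≤s z≤n) (≤-reflexive (sym πᵢ≡v)))) ⟩
      choices (at π i)                                   ≡⟨ cong choices πᵢ≡v ⟩
      weight (suc v)                                     ≡⟨ cong weight (sym πᵢ≡v) ⟩
      weight (at π i)                                    ∎
      where open ≡-Reasoning

  productFormula≡ : productFormula k ℓ n π ≡ product (applyUpTo (choices ∘ suc) m)
  productFormula≡ = begin
    product (map summand (oneTo n))
      ≡⟨ cong product (trans (cong (map summand) (oneTo≡applyUpTo n)) (List.map-applyUpTo suc summand n)) ⟩
    product (applyUpTo (summand ∘ suc) n)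
      ≡⟨ cong product (applyUpTo-cong n λ t t<n → summand≡weight (s≤s z≤n) t<n) ⟩
    product (applyUpTo (λ t → weight (at π (suc t))) n)
      ≡⟨ cong product (applyUpTo-at weight π) ⟩
    product (map weight π)
      ≡⟨ product-↭ (Perm.map⁺ weight π↭) ⟩
    product (map weight (replicate (n ∸ m) 0 ++ oneTo m))
      ≡⟨ cong product (List.map-++ weight (replicate (n ∸ m) 0) (oneTo m)) ⟩
    product (map weight (replicate (n ∸ m) 0) ++ map weight (oneTo m))
      ≡⟨ product-++ (map weight (replicate (n ∸ m) 0)) (map weight (oneTo m)) ⟩
    product (map weight (replicate (n ∸ m) 0)) * product (map weight (oneTo m))
      ≡⟨ cong (_* product (map weight (oneTo m))) (trans (cong product (List.map-replicate weight (n ∸ m) 0)) (product-replicate-1 (n ∸ m))) ⟩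
    1 * product (map weight (oneTo m))
      ≡⟨ *-identityˡ _ ⟩
    product (map weight (oneTo m))
      ≡⟨ cong product (trans (cong (map weight) (oneTo≡applyUpTo m)) (List.map-applyUpTo suc weight m)) ⟩
    product (applyUpTo (choices ∘ suc) m)
      ∎
    where open ≡-Reasoning

lemma2p14 : (k ℓ m n : ℕ) → 1 ≤ m → m ≤ n → (π : List ℕ) → π ↭ baseWord m n →
    countOutcome k ℓ m n π ≡ productFormula k ℓ n π
lemma2p14 k ℓ m n _ m≤n π π↭ with refl ← trans (Perm.↭-length π↭) (length-baseWord m≤n) =
  trans countOutcome≡ (sym productFormula≡)
  where open Factorisation k ℓ m π π↭
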